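{- Let $d>1$, $\varepsilon>0$, $r\ge1$, let $G\in\mathcal{A}^d_{\varepsilon,r}$ and let $F$ be an induced subgraph of $G$ with at least one vertex. Then there exists a non-empty subset $L\subset V(F)$ such that $|\partial_F(L)|\le\frac{d\varepsilon}{2}|L|$ and $|L|\le N^d_{2r}$.
   Context: $Gr_d$ is the set of finite simple graphs of maximum degree at most $d$. For a graph $F$ and $A\subset V(F)$, $\partial_F(A)$ is the set of vertices $x\in A$ having a neighbour in $F$ outside $A$. $N^d_{s}$ is the maximum number of vertices of a ball of radius $s$ with maximum degree at most $d$. $B_r(x,G)$ is the set of vertices at distance at most $r$ from $x$. $G\in Gr_d$ is $(\varepsilon,r)$-uniform if there is $\tilde f:V(G)\to\operatorname{Prob}(G)$ (probability measures on $V(G)$) with $\sum_z|\tilde f(x)(z)-\tilde f(y)(z)|<\varepsilon$ for all adjacent $x,y$ and $\operatorname{Supp}(\tilde f(x))\subset B_r(x,G)$ for all $x$; $\mathcal{A}^d_{\varepsilon,r}$ is the set of such graphs.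
   Formalization: The parameter ε is rational, and the probability measures $\tilde f(x)$ witnessing $(\varepsilon,r)$-uniformity take rational values. -}

module Defs where

open import Data.Nat as ℕ using (ℕ; zero; suc)
open import Data.Bool using (Bool; true; false; _∧_; _∨_; not)
open import Data.Fin using (Fin; zero; suc; _≟_)
open import Data.Fin.Subset using (Subset; ∣_∣)
open import Data.Vec using (tabulate)
open import Data.Rational as ℚ using (ℚ; 0ℚ; 1ℚ)
open import Relation.Nullary.Decidable using (isYes)
open import Relation.Binary.PropositionalEquality using (_≡_)

anyFin : {n : ℕ} → (Fin n → Bool) → Bool
anyFin {zero}  p = false
anyFin {suc n} p = p zero ∨ anyFin (λ i → p (suc i))

sumFin : {n : ℕ} → (Fin n → ℚ) → ℚ
sumFin {zero}  f = 0ℚ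
sumFin {suc n} f = f zero ℚ.+ sumFin (λ i → f (suc i))

record Graph : Set where
  field
    n     : ℕ
    adj   : Fin n → Fin n → Bool
    sym   : ∀ x y → adj x y ≡ adj y x
    irrefl : ∀ x → adj x x ≡ false

open Graph public

deg : (G : Graph) → Fin (n G) → ℕ
deg G x = ∣ tabulate (adj G x) ∣

InGr : ℕ → Graph → Set
InGr d G = ∀ x → deg G x ℕ.≤ d

within : (G : Graph) → ℕ → Fin (n G) → Fin (n G) → Bool
within G zero    x z = isYes (x ≟ z)
within G (suc k) x z = within G k x z ∨ anyFin (λ y → adj G x y ∧ within G k y z)

ball : (G : Graph) → ℕ → Fin (n G) → Subset (n G)
ball G k x = tabulate (within G k x)

-- (ε,r)-uniformity: f̃ x is a (rational-valued) probability measure on V(G)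
-- supported in B_r(x,G), with ℓ¹-distance < ε between adjacent vertices
Uniform : ℚ → ℕ → Graph → Set
Uniform ε r G =
  Σ' (Fin (n G) → Fin (n G) → ℚ) λ f →
      (∀ x z → 0ℚ ℚ.≤ f x z)
    × (∀ x → sumFin (f x) ≡ 1ℚ)
    × (∀ x z → within G r x z ≡ false → f x z ≡ 0ℚ)
    × (∀ x y → adj G x y ≡ true → sumFin (λ z → ℚ.∣ f x z ℚ.- f y z ∣) ℚ.< ε)
  where
    open import Data.Product using (_×_) renaming (Σ to Σ')

InA : ℕ → ℚ → ℕ → Graph → Set
InA d ε r G = InGr d G × Uniform ε r G
  where open import Data.Product using (_×_)

-- ∂_F(L) where F is the subgraph of G induced on S, and L ⊆ S
boundary : (G : Graph) → Subset (n G) → Subset (n G) → Subset (n G)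
boundary G S L = tabulate λ x →
  mem L x ∧ anyFin (λ y → adj G x y ∧ mem S y ∧ not (mem L y))
  where
    open import Data.Vec using (lookup)
    mem : Subset (n G) → Fin (n G) → Bool
    mem A i = lookup A i

-- m ≤ N^d_s : some ball of radius s in some graph of max degree ≤ d has at least m vertices
≤Nd : ℕ → ℕ → ℕ → Set
≤Nd m d s = Σ' Graph λ H → InGr d H × Σ' (Fin (n H)) λ v → m ℕ.≤ ∣ ball H s v ∣
  where open import Data.Product using (_×_) renaming (Σ to Σ')

ℕtoℚ : ℕ → ℚ
ℕtoℚ k = + k ℚ./ 1
  where open import Data.Integer using (+_)

{-# OPTIONS --safe #-}

-- For a centre z let mass z x = 1_F(x) f̃(x)(z), and let variation g sum (g x - g y)⁺ over the
-- ordered edges xy of F. Two probability vectors at ℓ¹-distance < ε satisfy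
-- Σ_z (f̃(x)(z) - f̃(y)(z))⁺ < ε/2, and every vertex has at most d neighbours, so
-- Σ_z variation (mass z) ≤ (dε/2)|F| = (dε/2) Σ_z Σ_x mass z x; hence some z has
-- variation (mass z) ≤ (dε/2) Σ_x mass z x.
--
-- A discrete co-area argument turns such a g ≥ 0 into a superlevel set. If h is the least
-- positive value of g and L₀ its support, then g = (g - h)⁺ + h·1_{L₀}; removing this bottom
-- layer lowers Σ g by h|L₀| and variation g by at least h|∂_F L₀|. So either L₀ has
-- |∂_F L₀| ≤ (dε/2)|L₀|, or (g - h)⁺ satisfies the strict inequality on a smaller support.
-- The set found lies in supp (mass z) ⊆ B_r(z), so |L| ≤ |B_{2r}(z, G)| ≤ N^d_{2r}.

module Submission where

open import Defs hiding (sym)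
open import Data.Nat using (ℕ; _<_; _≤_)
open import Data.Rational as ℚ using (ℚ; 0ℚ; ½)
open import Data.Fin.Subset using (Subset; _⊆_; Nonempty; ∣_∣)
open import Data.Product using (Σ; _×_)

import Data.Nat as ℕ
import Data.Nat.Properties as ℕP
open import Data.Nat.Induction using (<-wellFounded)
open import Induction.WellFounded using (Acc; acc)
import Data.Integer as ℤ
import Data.Integer.Properties as ℤP
open import Data.Rational using (1ℚ; _+_; _*_; _-_; -_; _⊔_; mkℚ) renaming (_≤_ to _≤ℚ_; _<_ to _<ℚ_)
import Data.Rational.Properties as ℚP
open import Data.Rational.Solver using (module +-*-Solver)
import Data.Nat.Coprimality as Coprimality
open import Algebra.Bundles using (Ring)
open import Algebra.Properties.Semiring.Sum (Ring.semiring ℚP.+-*-ring)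
  using (sum; sum-syntax; sum-cong-≗; ∑-distrib-+; ∑-comm; *-distribˡ-sum; *-distribʳ-sum; sum-replicate-zero)
open import Data.Bool using (Bool; true; false; _∧_; _∨_; not)
import Data.Bool.Properties as BoolP
open import Data.Fin using (Fin; zero; suc; _≟_)
import Data.Fin.Properties as FinP
open import Data.Fin.Subset using (_⊂_; _∈_)
import Data.Fin.Subset.Properties as SubsetP
open import Data.Vec using ([]; _∷_; lookup; tabulate)
import Data.Vec.Properties as VecP
open import Data.List using (filter; allFin)
open import Relation.Binary.Bundles using (DecTotalOrder)
open import Data.List.Extrema (DecTotalOrder.totalOrder ℚP.≤-decTotalOrder) using (argmin; argmin-all; f[argmin]≤f[xs])
open import Data.List.Relation.Unary.All as All using ()
open import Data.List.Relation.Unary.All.Properties using (all-filter)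
open import Data.List.Membership.Propositional.Properties using (∈-filter⁺; ∈-allFin)
open import Data.Product using (_,_; proj₁; ∃)
open import Data.Sum using (_⊎_; inj₁; inj₂)
open import Data.Empty using (⊥-elim)
open import Relation.Nullary using (yes; no; contradiction)
open import Relation.Nullary.Decidable using (does; dec-true; dec-false; _×-dec_)
open import Relation.Binary.PropositionalEquality
  using (_≡_; refl; sym; trans; cong; cong₂; subst; subst₂; module ≡-Reasoning)

open +-*-Solver

p≤q⇒0≤q-p : ∀ {p q} → p ≤ℚ q → 0ℚ ≤ℚ q - p
p≤q⇒0≤q-p {p} {q} p≤q = subst (_≤ℚ q - p) (ℚP.+-inverseʳ p) (ℚP.+-monoˡ-≤ (- p) p≤q)

p≤q⇒p-q≤0 : ∀ {p q} → p ≤ℚ q → p - q ≤ℚ 0ℚ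
p≤q⇒p-q≤0 {p} {q} p≤q = subst (p - q ≤ℚ_) (ℚP.+-inverseʳ q) (ℚP.+-monoˡ-≤ (- q) p≤q)

*-nonNeg : ∀ {p q} → 0ℚ ≤ℚ p → 0ℚ ≤ℚ q → 0ℚ ≤ℚ p * q
*-nonNeg {p} {q} 0≤p 0≤q =
  ℚP.nonNegative⁻¹ _ {{ℚP.nonNeg*nonNeg⇒nonNeg p {{ℚ.nonNegative 0≤p}} q {{ℚ.nonNegative 0≤q}}}}

+-cancelʳ-< : ∀ {p q} r → p + r <ℚ q + r → p <ℚ q
+-cancelʳ-< {p} {q} r p+r<q+r = subst₂ _<ℚ_ (cancel p) (cancel q) (ℚP.+-monoˡ-< (- r) p+r<q+r)
  where
  cancel : ∀ t → t + r - r ≡ t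
  cancel t = solve 2 (λ t r → t :+ r :- r := t) refl t r

0<c*s⇒0<s : ∀ c {s} → 0ℚ ≤ℚ s → 0ℚ <ℚ c * s → 0ℚ <ℚ s
0<c*s⇒0<s c {s} 0≤s 0<cs with 0ℚ ℚP.<? s
... | yes 0<s = 0<s
... | no 0≮s  = ⊥-elim (ℚP.<-irrefl (sym cs≡0) 0<cs)
  where
  cs≡0 : c * s ≡ 0ℚ
  cs≡0 = trans (cong (c *_) (ℚP.≤-antisym (ℚP.≮⇒≥ 0≮s) 0≤s)) (ℚP.*-zeroʳ c)

infix 10 _⁺

_⁺ : ℚ → ℚ
p ⁺ = p ⊔ 0ℚ

⁺-nonNeg : ∀ p → 0ℚ ≤ℚ p ⁺
⁺-nonNeg p = ℚP.p≤q⊔p p 0ℚ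

⁺-of-nonNeg : ∀ {p} → 0ℚ ≤ℚ p → p ⁺ ≡ p
⁺-of-nonNeg = ℚP.p≥q⇒p⊔q≡p

⁺-of-nonPos : ∀ {p} → p ≤ℚ 0ℚ → p ⁺ ≡ 0ℚ
⁺-of-nonPos = ℚP.p≤q⇒p⊔q≡q

p≤0⇒∣p∣≡-p : ∀ {p} → p ≤ℚ 0ℚ → ℚ.∣ p ∣ ≡ - p
p≤0⇒∣p∣≡-p {p} p≤0 = trans (sym (ℚP.∣-p∣≡∣p∣ p)) (ℚP.0≤p⇒∣p∣≡p (ℚP.neg-antimono-≤ p≤0))

⁺≡½[∣p∣+p] : ∀ p → p ⁺ ≡ ½ * (ℚ.∣ p ∣ + p)
⁺≡½[∣p∣+p] p with ℚP.≤-total 0ℚ p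
... | inj₁ 0≤p rewrite ⁺-of-nonNeg 0≤p | ℚP.0≤p⇒∣p∣≡p 0≤p =
  solve 1 (λ p → p := con ½ :* (p :+ p)) refl p
... | inj₂ p≤0 rewrite ⁺-of-nonPos p≤0 | p≤0⇒∣p∣≡-p p≤0 =
  solve 1 (λ p → con 0ℚ := con ½ :* ((:- p) :+ p)) refl p

-- Finite sums and cardinalities

sumFin≡sum : ∀ {m} (f : Fin m → ℚ) → sumFin f ≡ sum f
sumFin≡sum {ℕ.zero}  f = refl
sumFin≡sum {ℕ.suc m} f = cong (f zero +_) (sumFin≡sum (λ i → f (suc i)))

sum-mono-≤ : ∀ {m} {f g : Fin m → ℚ} → (∀ i → f i ≤ℚ g i) → sum f ≤ℚ sum g
sum-mono-≤ {ℕ.zero}  f≤g = ℚP.≤-refl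
sum-mono-≤ {ℕ.suc m} f≤g = ℚP.+-mono-≤ (f≤g zero) (sum-mono-≤ (λ i → f≤g (suc i)))

sum-mono-< : ∀ {m} {f g : Fin m → ℚ} → (∀ i → f i ≤ℚ g i) → ∃ (λ j → f j <ℚ g j) → sum f <ℚ sum g
sum-mono-< {ℕ.suc m} f≤g (zero , fj<gj) = ℚP.+-mono-<-≤ fj<gj (sum-mono-≤ (λ i → f≤g (suc i)))
sum-mono-< {ℕ.suc m} f≤g (suc j , fj<gj) = ℚP.+-mono-≤-< (f≤g zero) (sum-mono-< (λ i → f≤g (suc i)) (j , fj<gj))

sum-nonNeg : ∀ {m} {f : Fin m → ℚ} → (∀ i → 0ℚ ≤ℚ f i) → 0ℚ ≤ℚ sum f
sum-nonNeg {m} {f} 0≤f = subst (_≤ℚ sum f) (sum-replicate-zero m) (sum-mono-≤ 0≤f)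

sum-linear : ∀ {m} (c : ℚ) (f g : Fin m → ℚ) → ∑[ i < m ] (f i + c * g i) ≡ sum f + c * sum g
sum-linear c f g = trans (∑-distrib-+ f (λ i → c * g i)) (cong (sum f +_) (sym (*-distribˡ-sum c g)))

sum-linear-≤ : ∀ {m} (c : ℚ) {f g k : Fin m → ℚ} → (∀ i → f i + c * g i ≤ℚ k i) → sum f + c * sum g ≤ℚ sum k
sum-linear-≤ c {f} {g} pointwise = subst (_≤ℚ _) (sum-linear c f g) (sum-mono-≤ pointwise)

∑-distrib-difference : ∀ {m} (f g : Fin m → ℚ) → ∑[ i < m ] (f i - g i) ≡ sum f - sum g
∑-distrib-difference {ℕ.zero}  f g = refl
∑-distrib-difference {ℕ.suc m} f g =
  trans (cong (f zero - g zero +_) (∑-distrib-difference (λ i → f (suc i)) (λ i → g (suc i))))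
        (solve 4 (λ a b c d → (a :- b) :+ (c :- d) := (a :+ c) :- (b :+ d)) refl
               (f zero) (g zero) (sum (λ i → f (suc i))) (sum (λ i → g (suc i))))

∃-positive : ∀ {m} (f : Fin m → ℚ) → 0ℚ <ℚ sum f → ∃ λ i → 0ℚ <ℚ f i
∃-positive {m} f 0<∑f with FinP.any? (λ i → 0ℚ ℚP.<? f i)
... | yes ∃i = ∃i
... | no ∄i = ⊥-elim (ℚP.<-irrefl refl (ℚP.<-≤-trans 0<∑f ∑f≤0))
  where
  ∑f≤0 : sum f ≤ℚ 0ℚ
  ∑f≤0 = subst (sum f ≤ℚ_) (sum-replicate-zero m) (sum-mono-≤ (λ i → ℚP.≮⇒≥ (λ 0<fi → ∄i (i , 0<fi))))

ratio-pigeonhole : ∀ {m} (c : ℚ) (a b : Fin m → ℚ) → (∀ i → 0ℚ ≤ℚ a i) → (∀ i → 0ℚ ≤ℚ b i) →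
                   0ℚ <ℚ sum b → sum a ≤ℚ c * sum b → ∃ λ i → 0ℚ <ℚ b i × a i ≤ℚ c * b i
ratio-pigeonhole c a b 0≤a 0≤b 0<∑b ∑a≤c∑b
  with FinP.any? (λ i → (0ℚ ℚP.<? b i) ×-dec (a i ℚP.≤? c * b i))
... | yes found = found
... | no none = ⊥-elim (ℚP.<-irrefl refl (ℚP.<-≤-trans c∑b<∑a ∑a≤c∑b))
  where
  cb≤a : ∀ i → c * b i ≤ℚ a i
  cb≤a i with 0ℚ ℚP.<? b i
  ... | yes 0<bi = ℚP.<⇒≤ (ℚP.≰⇒> (λ ai≤cbi → none (i , 0<bi , ai≤cbi)))
  ... | no 0≮bi = begin
    c * b i ≡⟨ cong (c *_) (ℚP.≤-antisym (ℚP.≮⇒≥ 0≮bi) (0≤b i)) ⟩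
    c * 0ℚ  ≡⟨ ℚP.*-zeroʳ c ⟩
    0ℚ      ≤⟨ 0≤a i ⟩
    a i     ∎
    where open ℚP.≤-Reasoning

  c∑b<∑a : c * sum b <ℚ sum a
  c∑b<∑a with ∃-positive b 0<∑b
  ... | i , 0<bi = subst (_<ℚ sum a) (sym (*-distribˡ-sum c b))
    (sum-mono-< cb≤a (i , ℚP.≰⇒> (λ ai≤cbi → none (i , 0<bi , ai≤cbi))))

sum-⁺-difference : ∀ {m} (p q : Fin m → ℚ) → sum p ≡ sum q →
                   ∑[ i < m ] ((p i - q i) ⁺) ≡ ½ * (∑[ i < m ] ℚ.∣ p i - q i ∣)
sum-⁺-difference {m} p q ∑p≡∑q = begin
  ∑[ i < m ] ((p i - q i) ⁺)                        ≡⟨ sum-cong-≗ (λ i → ⁺≡½[∣p∣+p] (p i - q i)) ⟩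
  ∑[ i < m ] (½ * (∣p-q∣ i + (p i - q i)))          ≡⟨ sym (*-distribˡ-sum ½ (λ i → ∣p-q∣ i + (p i - q i))) ⟩
  ½ * (∑[ i < m ] (∣p-q∣ i + (p i - q i)))          ≡⟨ cong (½ *_) (∑-distrib-+ ∣p-q∣ _) ⟩
  ½ * (sum ∣p-q∣ + (∑[ i < m ] (p i - q i)))        ≡⟨ cong (λ t → ½ * (sum ∣p-q∣ + t)) (∑-distrib-difference p q) ⟩
  ½ * (sum ∣p-q∣ + (sum p - sum q))                 ≡⟨ cong (λ t → ½ * (sum ∣p-q∣ + (t - sum q))) ∑p≡∑q ⟩
  ½ * (sum ∣p-q∣ + (sum q - sum q))                 ≡⟨ solve 2 (λ a b → con ½ :* (a :+ (b :- b)) := con ½ :* a) refl (sum ∣p-q∣) (sum q) ⟩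
  ½ * sum ∣p-q∣                                     ∎
  where
  open ≡-Reasoning
  ∣p-q∣ : Fin m → ℚ
  ∣p-q∣ i = ℚ.∣ p i - q i ∣

𝟙 : Bool → ℚ
𝟙 true  = 1ℚ
𝟙 false = 0ℚ

𝟙-nonNeg : ∀ b → 0ℚ ≤ℚ 𝟙 b
𝟙-nonNeg true  = ℚP.nonNegative⁻¹ 1ℚ
𝟙-nonNeg false = ℚP.≤-refl

𝟙-∧ : ∀ a b → 𝟙 (a ∧ b) ≡ 𝟙 a * 𝟙 b
𝟙-∧ true  b = sym (ℚP.*-identityˡ (𝟙 b))
𝟙-∧ false b = sym (ℚP.*-zeroˡ (𝟙 b))

𝟙-∨ : ∀ a b → 𝟙 (a ∨ b) ≤ℚ 𝟙 a + 𝟙 b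
𝟙-∨ true  b = ℚP.≤-trans (ℚP.≤-reflexive (sym (ℚP.+-identityʳ 1ℚ))) (ℚP.+-monoʳ-≤ 1ℚ (𝟙-nonNeg b))
𝟙-∨ false b = ℚP.≤-reflexive (sym (ℚP.+-identityˡ (𝟙 b)))

𝟙-∧-≤ˡ : ∀ a b → 𝟙 (a ∧ b) ≤ℚ 𝟙 a
𝟙-∧-≤ˡ true  true  = ℚP.≤-refl
𝟙-∧-≤ˡ true  false = 𝟙-nonNeg true
𝟙-∧-≤ˡ false b     = ℚP.≤-refl

𝟙-*-mono-≤ : ∀ b {p q} → (b ≡ true → p ≤ℚ q) → 𝟙 b * p ≤ℚ 𝟙 b * q
𝟙-*-mono-≤ true  {p} {q} p≤q = subst₂ _≤ℚ_ (sym (ℚP.*-identityˡ p)) (sym (ℚP.*-identityˡ q)) (p≤q refl)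
𝟙-*-mono-≤ false {p} {q} _   = ℚP.≤-reflexive (trans (ℚP.*-zeroˡ p) (sym (ℚP.*-zeroˡ q)))

ℕtoℚ≡mkℚ : ∀ k → ℕtoℚ k ≡ mkℚ (ℤ.+ k) 0 (Coprimality.sym (Coprimality.1-coprimeTo k))
ℕtoℚ≡mkℚ k = ℚP.↥p/↧p≡p _

-- Once k/1 is in normal form, 1ℚ + k/1 computes to (1 + k·1)/1.
ℕtoℚ-suc : ∀ k → ℕtoℚ (ℕ.suc k) ≡ 1ℚ + ℕtoℚ k
ℕtoℚ-suc k rewrite ℕtoℚ≡mkℚ k = cong (λ i → (ℤ.+ 1 ℤ.+ i) ℚ./ 1) (sym (ℤP.*-identityʳ (ℤ.+ k)))

ℕtoℚ-nonNeg : ∀ k → 0ℚ ≤ℚ ℕtoℚ k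
ℕtoℚ-nonNeg ℕ.zero    = ℚP.≤-refl
ℕtoℚ-nonNeg (ℕ.suc k) rewrite ℕtoℚ-suc k = ℚP.+-mono-≤ (ℚP.nonNegative⁻¹ 1ℚ) (ℕtoℚ-nonNeg k)

ℕtoℚ-mono-≤ : ∀ {j k} → j ≤ k → ℕtoℚ j ≤ℚ ℕtoℚ k
ℕtoℚ-mono-≤ {k = k} ℕ.z≤n = ℕtoℚ-nonNeg k
ℕtoℚ-mono-≤ {ℕ.suc j} {ℕ.suc k} (ℕ.s≤s j≤k) rewrite ℕtoℚ-suc j | ℕtoℚ-suc k = ℚP.+-monoʳ-≤ 1ℚ (ℕtoℚ-mono-≤ j≤k)

ℕtoℚ-∣p∣ : ∀ {m} (p : Subset m) → ℕtoℚ ∣ p ∣ ≡ ∑[ i < m ] 𝟙 (lookup p i)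
ℕtoℚ-∣p∣ []          = refl
ℕtoℚ-∣p∣ (true ∷ p)  = trans (ℕtoℚ-suc ∣ p ∣) (cong (1ℚ +_) (ℕtoℚ-∣p∣ p))
ℕtoℚ-∣p∣ (false ∷ p) = trans (ℕtoℚ-∣p∣ p) (sym (ℚP.+-identityˡ _))

ℕtoℚ-∣p∣-positive : ∀ {m} {p : Subset m} → Nonempty p → 0ℚ <ℚ ℕtoℚ ∣ p ∣
ℕtoℚ-∣p∣-positive (x , x∈p) =
  ℚP.<-≤-trans (ℚP.positive⁻¹ 1ℚ) (ℕtoℚ-mono-≤ (ℕP.≤-<-trans ℕ.z≤n (SubsetP.x∈p⇒∣p-x∣<∣p∣ x∈p)))

ℕtoℚ-∣tabulate∣ : ∀ {m} (P : Fin m → Bool) → ℕtoℚ ∣ tabulate P ∣ ≡ ∑[ i < m ] 𝟙 (P i)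
ℕtoℚ-∣tabulate∣ P = trans (ℕtoℚ-∣p∣ (tabulate P)) (sum-cong-≗ (λ i → cong 𝟙 (VecP.lookup∘tabulate P i)))

∨-true⁻ : ∀ a {b} → a ∨ b ≡ true → a ≡ true ⊎ b ≡ true
∨-true⁻ true  _  = inj₁ refl
∨-true⁻ false b≡ = inj₂ b≡

anyFin⁺ : ∀ {m} (P : Fin m → Bool) {i} → P i ≡ true → anyFin P ≡ true
anyFin⁺ P {zero}  Pi≡ rewrite Pi≡ = refl
anyFin⁺ P {suc i} Pi≡ rewrite anyFin⁺ (λ j → P (suc j)) Pi≡ = BoolP.∨-zeroʳ (P zero)

anyFin⁻ : ∀ {m} (P : Fin m → Bool) → anyFin P ≡ true → ∃ λ i → P i ≡ true
anyFin⁻ {ℕ.suc m} P any≡ with ∨-true⁻ (P zero) any≡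
... | inj₁ P0≡ = zero , P0≡
... | inj₂ rest with anyFin⁻ (λ j → P (suc j)) rest
...   | i , Pi≡ = suc i , Pi≡

𝟙-anyFin : ∀ {m} (P : Fin m → Bool) → 𝟙 (anyFin P) ≤ℚ ∑[ i < m ] 𝟙 (P i)
𝟙-anyFin {ℕ.zero}  P = ℚP.≤-refl
𝟙-anyFin {ℕ.suc m} P =
  ℚP.≤-trans (𝟙-∨ (P zero) (anyFin (λ j → P (suc j)))) (ℚP.+-monoʳ-≤ (𝟙 (P zero)) (𝟙-anyFin (λ j → P (suc j))))

𝟙-∧-anyFin : ∀ {m} b (P : Fin m → Bool) → 𝟙 (b ∧ anyFin P) ≤ℚ ∑[ i < m ] 𝟙 (b ∧ P i)
𝟙-∧-anyFin true  P = 𝟙-anyFin P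
𝟙-∧-anyFin {m} false P = ℚP.≤-reflexive (sym (sum-replicate-zero m))

∧-regroup : ∀ l s a t e → (l ≡ true → s ≡ true) → l ∧ (a ∧ (t ∧ e)) ≡ (s ∧ (a ∧ t)) ∧ (l ∧ e)
∧-regroup false s a t e _    = sym (BoolP.∧-zeroʳ (s ∧ (a ∧ t)))
∧-regroup true  s a t e l⇒s rewrite l⇒s refl = sym (BoolP.∧-assoc a t e)

∈-tabulate⁺ : ∀ {m} (P : Fin m → Bool) {x} → P x ≡ true → x ∈ tabulate P
∈-tabulate⁺ P {x} Px≡ = VecP.lookup⇒[]= x (tabulate P) (trans (VecP.lookup∘tabulate P x) Px≡)

∈-tabulate⁻ : ∀ {m} (P : Fin m → Bool) {x} → x ∈ tabulate P → P x ≡ true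
∈-tabulate⁻ P {x} x∈ = trans (sym (VecP.lookup∘tabulate P x)) (VecP.[]=⇒lookup x∈)

-- Balls

module _ (G : Graph) where

  within-suc : ∀ k {x z} → within G k x z ≡ true → within G (ℕ.suc k) x z ≡ true
  within-suc k w rewrite w = refl

  within-cons : ∀ k {x y z} → adj G x y ≡ true → within G k y z ≡ true → within G (ℕ.suc k) x z ≡ true
  within-cons k {x} {y} {z} a w =
    trans (cong (within G k x z ∨_) (anyFin⁺ (λ y′ → adj G x y′ ∧ within G k y′ z) (cong₂ _∧_ a w)))
          (BoolP.∨-zeroʳ (within G k x z))

  within-suc⁻ : ∀ k {x z} → within G (ℕ.suc k) x z ≡ true →
                within G k x z ≡ true ⊎ ∃ λ y → adj G x y ≡ true × within G k y z ≡ true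
  within-suc⁻ k {x} {z} w with ∨-true⁻ (within G k x z) w
  ... | inj₁ w′ = inj₁ w′
  ... | inj₂ step with anyFin⁻ (λ y → adj G x y ∧ within G k y z) step
  ...   | y , a∧w = inj₂ (y , BoolP.∧-conicalˡ _ _ a∧w , BoolP.∧-conicalʳ _ _ a∧w)

  within-zero-refl : ∀ x → within G 0 x x ≡ true
  within-zero-refl x with x ≟ x
  ... | yes _  = refl
  ... | no x≢x = ⊥-elim (x≢x refl)

  within-zero⁻ : ∀ {x z} → within G 0 x z ≡ true → x ≡ z
  within-zero⁻ {x} {z} w with x ≟ z
  ... | yes x≡z = x≡z

  within-snoc : ∀ k {x y z} → within G k x y ≡ true → adj G y z ≡ true → within G (ℕ.suc k) x z ≡ true
  within-snoc ℕ.zero {z = z} w a with within-zero⁻ w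
  ... | refl = within-cons 0 a (within-zero-refl z)
  within-snoc (ℕ.suc k) w a with within-suc⁻ k w
  ... | inj₁ w′ = within-suc (ℕ.suc k) (within-snoc k w′ a)
  ... | inj₂ (y′ , a′ , w′) = within-cons (ℕ.suc k) a′ (within-snoc k w′ a)

  within-sym : ∀ k {x z} → within G k x z ≡ true → within G k z x ≡ true
  within-sym ℕ.zero {x} w with within-zero⁻ w
  ... | refl = within-zero-refl x
  within-sym (ℕ.suc k) {x} w with within-suc⁻ k w
  ... | inj₁ w′ = within-suc k (within-sym k w′)
  ... | inj₂ (y , a , w′) = within-snoc k (within-sym k w′) (trans (Graph.sym G y x) a)

  within-mono : ∀ {j k x z} → j ≤ k → within G j x z ≡ true → within G k x z ≡ true
  within-mono {k = ℕ.zero} ℕ.z≤n w = w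
  within-mono {k = ℕ.suc k} j≤1+k w with ℕP.m≤n⇒m<n∨m≡n j≤1+k
  ... | inj₁ (ℕ.s≤s j≤k) = within-suc k (within-mono j≤k w)
  ... | inj₂ refl        = w

-- Layer-cake decomposition

support : ∀ {m} → (Fin m → ℚ) → Subset m
support g = tabulate (λ x → does (0ℚ ℚP.<? g x))

support⁺ : ∀ {m} (g : Fin m → ℚ) {x} → 0ℚ <ℚ g x → x ∈ support g
support⁺ g {x} 0<gx = ∈-tabulate⁺ (λ y → does (0ℚ ℚP.<? g y)) (dec-true (0ℚ ℚP.<? g x) 0<gx)

support⁻ : ∀ {m} (g : Fin m → ℚ) {x} → x ∈ support g → 0ℚ <ℚ g x
support⁻ g {x} x∈ with 0ℚ ℚP.<? g x
... | yes 0<gx = 0<gx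
... | no 0≮gx  = contradiction
  (trans (sym (dec-false (0ℚ ℚP.<? g x) 0≮gx)) (∈-tabulate⁻ (λ y → does (0ℚ ℚP.<? g y)) x∈)) λ ()

data Layered {m} (g g′ : Fin m → ℚ) (h : ℚ) (L : Subset m) (x : Fin m) : Set where
  on  : lookup L x ≡ true  → g x ≡ g′ x + h → Layered g g′ h L x
  off : lookup L x ≡ false → g x ≡ 0ℚ → g′ x ≡ 0ℚ → Layered g g′ h L x

module _ {m} {g g′ : Fin m → ℚ} {h : ℚ} {L : Subset m} where

  sum-layered : (∀ x → Layered g g′ h L x) → sum g ≡ sum g′ + h * ℕtoℚ ∣ L ∣
  sum-layered layered = begin
    sum g                                    ≡⟨ sum-cong-≗ (λ x → pointwise x (layered x)) ⟩
    ∑[ x < m ] (g′ x + h * 𝟙 (lookup L x))   ≡⟨ sum-linear h g′ (λ x → 𝟙 (lookup L x)) ⟩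
    sum g′ + h * ∑[ x < m ] 𝟙 (lookup L x)   ≡⟨ cong (λ t → sum g′ + h * t) (sym (ℕtoℚ-∣p∣ L)) ⟩
    sum g′ + h * ℕtoℚ ∣ L ∣                  ∎
    where
    open ≡-Reasoning
    pointwise : ∀ x → Layered g g′ h L x → g x ≡ g′ x + h * 𝟙 (lookup L x)
    pointwise x (on Lx gx≡) rewrite Lx = trans gx≡ (cong (g′ x +_) (sym (ℚP.*-identityʳ h)))
    pointwise x (off Lx gx≡0 g′x≡0) rewrite Lx | gx≡0 | g′x≡0 = sym (trans (ℚP.+-identityˡ _) (ℚP.*-zeroʳ h))

  support-layered : (∀ x → Layered g g′ h L x) → support g′ ⊆ L
  support-layered layered {x} x∈ with layered x
  ... | on Lx _ = VecP.lookup⇒[]= x L Lx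
  ... | off _ _ g′x≡0 = ⊥-elim (ℚP.<-irrefl (sym g′x≡0) (support⁻ g′ x∈))

  ⁺-layered : 0ℚ ≤ℚ h → (∀ x → 0ℚ ≤ℚ g′ x) → ∀ {x y} → Layered g g′ h L x → Layered g g′ h L y →
              (g′ x - g′ y) ⁺ + h * 𝟙 (lookup L x ∧ not (lookup L y)) ≤ℚ (g x - g y) ⁺
  ⁺-layered 0≤h 0≤g′ {x} {y} (on Lx gx≡) (on Ly gy≡) rewrite Lx | Ly = ℚP.≤-reflexive (begin
    (g′ x - g′ y) ⁺ + h * 0ℚ   ≡⟨ trans (cong ((g′ x - g′ y) ⁺ +_) (ℚP.*-zeroʳ h)) (ℚP.+-identityʳ _) ⟩
    (g′ x - g′ y) ⁺            ≡⟨ cong _⁺ (solve 3 (λ a b h → a :- b := (a :+ h) :- (b :+ h)) refl (g′ x) (g′ y) h) ⟩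
    ((g′ x + h) - (g′ y + h)) ⁺ ≡⟨ sym (cong₂ (λ s t → (s - t) ⁺) gx≡ gy≡) ⟩
    (g x - g y) ⁺              ∎)
    where open ≡-Reasoning
  ⁺-layered 0≤h 0≤g′ {x} {y} (on Lx gx≡) (off Ly gy≡0 g′y≡0) rewrite Lx | Ly | gy≡0 | g′y≡0 = ℚP.≤-reflexive (begin
    (g′ x - 0ℚ) ⁺ + h * 1ℚ      ≡⟨ cong₂ _+_ (trans (cong _⁺ (ℚP.+-identityʳ (g′ x))) (⁺-of-nonNeg (0≤g′ x))) (ℚP.*-identityʳ h) ⟩
    g′ x + h                    ≡⟨ sym gx≡ ⟩
    g x                         ≡⟨ sym (trans (cong _⁺ (ℚP.+-identityʳ (g x))) (⁺-of-nonNeg 0≤gx)) ⟩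
    (g x - 0ℚ) ⁺                ∎)
    where
    open ≡-Reasoning
    0≤gx : 0ℚ ≤ℚ g x
    0≤gx = subst (0ℚ ≤ℚ_) (sym gx≡) (ℚP.+-mono-≤ (0≤g′ x) 0≤h)
  ⁺-layered 0≤h 0≤g′ {x} {y} (off Lx _ g′x≡0) _ rewrite Lx | g′x≡0 = begin
    (0ℚ - g′ y) ⁺ + h * 0ℚ  ≡⟨ cong₂ _+_ (⁺-of-nonPos (p≤q⇒p-q≤0 (0≤g′ y))) (ℚP.*-zeroʳ h) ⟩
    0ℚ                      ≤⟨ ⁺-nonNeg (g x - g y) ⟩
    (g x - g y) ⁺           ∎
    where open ℚP.≤-Reasoning

minimal-positive : ∀ {m} (g : Fin m → ℚ) → ∃ (λ j → 0ℚ <ℚ g j) →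
                   ∃ λ x₀ → 0ℚ <ℚ g x₀ × (∀ x → 0ℚ <ℚ g x → g x₀ ≤ℚ g x)
minimal-positive {m} g (j , 0<gj) =
  x₀ , argmin-all g 0<gj (all-filter positive? (allFin m)) ,
  λ x 0<gx → All.lookup (f[argmin]≤f[xs] j positives) (∈-filter⁺ positive? (∈-allFin x) 0<gx)
  where
  positive? = λ x → 0ℚ ℚP.<? g x
  positives = filter positive? (allFin m)
  x₀ = argmin g j positives

module _ {m} (g : Fin m → ℚ) (0≤g : ∀ x → 0ℚ ≤ℚ g x)
         {x₀} (0<gx₀ : 0ℚ <ℚ g x₀) (minimal : ∀ x → 0ℚ <ℚ g x → g x₀ ≤ℚ g x) where

  peeled : Fin m → ℚ
  peeled x = (g x - g x₀) ⁺

  peeled-layered : ∀ x → Layered g peeled (g x₀) (support g) x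
  peeled-layered x with 0ℚ ℚP.<? g x
  ... | yes 0<gx = on
    (trans (VecP.lookup∘tabulate _ x) (dec-true (0ℚ ℚP.<? g x) 0<gx))
    (begin
      g x                    ≡⟨ solve 2 (λ a b → a := (a :- b) :+ b) refl (g x) (g x₀) ⟩
      (g x - g x₀) + g x₀    ≡⟨ cong (_+ g x₀) (sym (⁺-of-nonNeg (p≤q⇒0≤q-p (minimal x 0<gx)))) ⟩
      peeled x + g x₀        ∎)
    where open ≡-Reasoning
  ... | no 0≮gx = off
    (trans (VecP.lookup∘tabulate _ x) (dec-false (0ℚ ℚP.<? g x) 0≮gx))
    gx≡0
    (⁺-of-nonPos (p≤q⇒p-q≤0 (subst (_≤ℚ g x₀) (sym gx≡0) (ℚP.<⇒≤ 0<gx₀))))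
    where
    gx≡0 : g x ≡ 0ℚ
    gx≡0 = ℚP.≤-antisym (ℚP.≮⇒≥ 0≮gx) (0≤g x)

  support-peeled-⊂ : support peeled ⊂ support g
  support-peeled-⊂ = support-layered peeled-layered , x₀ , support⁺ g 0<gx₀ , λ x₀∈ →
    ℚP.<-irrefl (sym peeled-x₀) (support⁻ peeled {x₀} x₀∈)
    where
    peeled-x₀ : peeled x₀ ≡ 0ℚ
    peeled-x₀ = trans (cong _⁺ (ℚP.+-inverseʳ (g x₀))) (⁺-of-nonNeg ℚP.≤-refl)

-- Edge variation in the induced subgraph F

module _ (G : Graph) (S : Subset (n G)) where

  edge : Fin (n G) → Fin (n G) → Bool
  edge x y = lookup S x ∧ (adj G x y ∧ lookup S y)

  exits : Subset (n G) → Fin (n G) → Fin (n G) → Bool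
  exits L x y = adj G x y ∧ (lookup S y ∧ not (lookup L y))

  leaves : Subset (n G) → Fin (n G) → Fin (n G) → Bool
  leaves L x y = lookup L x ∧ exits L x y

  variation : (Fin (n G) → ℚ) → ℚ
  variation g = ∑[ x < n G ] (∑[ y < n G ] (𝟙 (edge x y) * (g x - g y) ⁺))

  cut : Subset (n G) → ℚ
  cut L = ∑[ x < n G ] (∑[ y < n G ] 𝟙 (leaves L x y))

  ∣boundary∣≤cut : ∀ L → ℕtoℚ ∣ boundary G S L ∣ ≤ℚ cut L
  ∣boundary∣≤cut L = ℚP.≤-trans (ℚP.≤-reflexive (ℕtoℚ-∣tabulate∣ (λ x → lookup L x ∧ anyFin (exits L x))))
    (sum-mono-≤ (λ x → 𝟙-∧-anyFin (lookup L x) (exits L x)))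

  variation-nonNeg : ∀ g → 0ℚ ≤ℚ variation g
  variation-nonNeg g = sum-nonNeg (λ x → sum-nonNeg (λ y → *-nonNeg (𝟙-nonNeg (edge x y)) (⁺-nonNeg (g x - g y))))

  induced-degree≤ : ∀ {d} → InGr d G → ∀ x → ∑[ y < n G ] 𝟙 (edge x y) ≤ℚ 𝟙 (lookup S x) * ℕtoℚ d
  induced-degree≤ {d} deg≤d x = begin
    ∑[ y < n G ] 𝟙 (edge x y)                              ≡⟨ sum-cong-≗ (λ y → 𝟙-∧ (lookup S x) (adj G x y ∧ lookup S y)) ⟩
    ∑[ y < n G ] (𝟙 (lookup S x) * 𝟙 (adj G x y ∧ lookup S y)) ≡⟨ sym (*-distribˡ-sum (𝟙 (lookup S x)) (λ y → 𝟙 (adj G x y ∧ lookup S y))) ⟩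
    𝟙 (lookup S x) * ∑[ y < n G ] 𝟙 (adj G x y ∧ lookup S y)  ≤⟨ 𝟙-*-mono-≤ (lookup S x) (λ _ → degree-bound) ⟩
    𝟙 (lookup S x) * ℕtoℚ d                                 ∎
    where
    open ℚP.≤-Reasoning
    degree-bound : ∑[ y < n G ] 𝟙 (adj G x y ∧ lookup S y) ≤ℚ ℕtoℚ d
    degree-bound = begin
      ∑[ y < n G ] 𝟙 (adj G x y ∧ lookup S y) ≤⟨ sum-mono-≤ (λ y → 𝟙-∧-≤ˡ (adj G x y) (lookup S y)) ⟩
      ∑[ y < n G ] 𝟙 (adj G x y)              ≡⟨ sym (ℕtoℚ-∣tabulate∣ (adj G x)) ⟩
      ℕtoℚ (deg G x)                          ≤⟨ ℕtoℚ-mono-≤ (deg≤d x) ⟩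
      ℕtoℚ d                                  ∎

  module _ {L : Subset (n G)} (L⊆S : L ⊆ S) where

    leaves≡edge∧ : ∀ x y → leaves L x y ≡ edge x y ∧ (lookup L x ∧ not (lookup L y))
    leaves≡edge∧ x y = ∧-regroup (lookup L x) (lookup S x) (adj G x y) (lookup S y) (not (lookup L y))
      (λ Lx → VecP.[]=⇒lookup (L⊆S (VecP.lookup⇒[]= x L Lx)))

    variation-layered : ∀ {g g′ h} → 0ℚ ≤ℚ h → (∀ x → 0ℚ ≤ℚ g′ x) → (∀ x → Layered g g′ h L x) →
                        variation g′ + h * cut L ≤ℚ variation g
    variation-layered {g} {g′} {h} 0≤h 0≤g′ layered = sum-linear-≤ h (λ x → sum-linear-≤ h (λ y → edgewise x y))
      where
      edgewise : ∀ x y → 𝟙 (edge x y) * (g′ x - g′ y) ⁺ + h * 𝟙 (leaves L x y) ≤ℚ 𝟙 (edge x y) * (g x - g y) ⁺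
      edgewise x y = begin
        𝟙 e * (g′ x - g′ y) ⁺ + h * 𝟙 (leaves L x y)     ≡⟨ cong (λ b → 𝟙 e * (g′ x - g′ y) ⁺ + h * 𝟙 b) (leaves≡edge∧ x y) ⟩
        𝟙 e * (g′ x - g′ y) ⁺ + h * 𝟙 (e ∧ jump)         ≡⟨ cong (λ t → 𝟙 e * (g′ x - g′ y) ⁺ + h * t) (𝟙-∧ e jump) ⟩
        𝟙 e * (g′ x - g′ y) ⁺ + h * (𝟙 e * 𝟙 jump)      ≡⟨ solve 4 (λ i a h j → i :* a :+ h :* (i :* j) := i :* (a :+ h :* j)) refl
                                                              (𝟙 e) ((g′ x - g′ y) ⁺) h (𝟙 jump) ⟩
        𝟙 e * ((g′ x - g′ y) ⁺ + h * 𝟙 jump)            ≤⟨ 𝟙-*-mono-≤ e (λ _ → ⁺-layered 0≤h 0≤g′ (layered x) (layered y)) ⟩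
        𝟙 e * (g x - g y) ⁺                             ∎
        where
        open ℚP.≤-Reasoning
        e    = edge x y
        jump = lookup L x ∧ not (lookup L y)

    variation-peeled-< : ∀ c {g g′ h} → 0ℚ <ℚ h → (∀ x → 0ℚ ≤ℚ g′ x) → (∀ x → Layered g g′ h L x) →
                         variation g ≤ℚ c * sum g → c * ℕtoℚ ∣ L ∣ <ℚ ℕtoℚ ∣ boundary G S L ∣ →
                         variation g′ <ℚ c * sum g′
    variation-peeled-< c {g} {g′} {h} 0<h 0≤g′ layered var≤ large = +-cancelʳ-< (h * cut L) (begin-strict
      variation g′ + h * cut L            ≤⟨ variation-layered (ℚP.<⇒≤ 0<h) 0≤g′ layered ⟩
      variation g                         ≤⟨ var≤ ⟩
      c * sum g                           ≡⟨ cong (c *_) (sum-layered layered) ⟩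
      c * (sum g′ + h * ℕtoℚ ∣ L ∣)       ≡⟨ solve 4 (λ c s h l → c :* (s :+ h :* l) := c :* s :+ h :* (c :* l)) refl
                                               c (sum g′) h (ℕtoℚ ∣ L ∣) ⟩
      c * sum g′ + h * (c * ℕtoℚ ∣ L ∣)   <⟨ ℚP.+-monoʳ-< (c * sum g′)
                                               (ℚP.*-monoʳ-<-pos h {{ℚ.positive 0<h}} (ℚP.<-≤-trans large (∣boundary∣≤cut L))) ⟩
      c * sum g′ + h * cut L              ∎)
      where open ℚP.≤-Reasoning

  SmallSuperlevelSet : ℚ → (Fin (n G) → ℚ) → Set
  SmallSuperlevelSet c g =
    Σ (Subset (n G)) λ L → L ⊆ support g × Nonempty L × ℕtoℚ ∣ boundary G S L ∣ ≤ℚ c * ℕtoℚ ∣ L ∣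

  small-superlevel-set : ∀ c (g : Fin (n G) → ℚ) → (∀ x → 0ℚ ≤ℚ g x) → support g ⊆ S →
                         0ℚ <ℚ sum g → variation g ≤ℚ c * sum g → SmallSuperlevelSet c g
  small-superlevel-set c g = go g (<-wellFounded ∣ support g ∣)
    where
    shrink : ∀ g g′ → support g′ ⊆ support g → SmallSuperlevelSet c g′ → SmallSuperlevelSet c g
    shrink _ _ supp′⊆ (L , L⊆ , nonempty , small) = L , SubsetP.⊆-trans L⊆ supp′⊆ , nonempty , small

    go : ∀ g → Acc _<_ ∣ support g ∣ → (∀ x → 0ℚ ≤ℚ g x) → support g ⊆ S →
         0ℚ <ℚ sum g → variation g ≤ℚ c * sum g → SmallSuperlevelSet c g
    go g (acc smaller) 0≤g supp⊆S 0<∑g var≤ with minimal-positive g (∃-positive g 0<∑g)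
    ... | x₀ , 0<gx₀ , minimal with ℕtoℚ ∣ boundary G S (support g) ∣ ℚP.≤? c * ℕtoℚ ∣ support g ∣
    ...   | yes small = support g , SubsetP.⊆-refl , (x₀ , support⁺ g 0<gx₀) , small
    ...   | no large  = shrink g g′ (proj₁ peeled⊂) (go g′ (smaller (SubsetP.p⊂q⇒∣p∣<∣q∣ peeled⊂))
                          0≤g′ (SubsetP.⊆-trans (proj₁ peeled⊂) supp⊆S) 0<∑g′ (ℚP.<⇒≤ var′<))
      where
      g′ = peeled g 0≤g 0<gx₀ minimal
      peeled⊂ = support-peeled-⊂ g 0≤g 0<gx₀ minimal

      0≤g′ : ∀ x → 0ℚ ≤ℚ g′ x
      0≤g′ x = ⁺-nonNeg (g x - g x₀)

      var′< : variation g′ <ℚ c * sum g′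
      var′< = variation-peeled-< supp⊆S c 0<gx₀ 0≤g′ (peeled-layered g 0≤g 0<gx₀ minimal) var≤ (ℚP.≰⇒> large)

      0<∑g′ : 0ℚ <ℚ sum g′
      0<∑g′ = 0<c*s⇒0<s c (sum-nonNeg 0≤g′) (ℚP.≤-<-trans (variation-nonNeg g′) var′<)

-- Averaging over centres

module _ (G : Graph) (S : Subset (n G)) (f : Fin (n G) → Fin (n G) → ℚ) where

  mass : Fin (n G) → Fin (n G) → ℚ
  mass z x = 𝟙 (lookup S x) * f x z

  mass-on-S : ∀ z {x} → lookup S x ≡ true → mass z x ≡ f x z
  mass-on-S z {x} Sx rewrite Sx = ℚP.*-identityˡ (f x z)

  mass-nonNeg : (∀ x z → 0ℚ ≤ℚ f x z) → ∀ z x → 0ℚ ≤ℚ mass z x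
  mass-nonNeg 0≤f z x = *-nonNeg (𝟙-nonNeg (lookup S x)) (0≤f x z)

  support-mass⊆S : ∀ z → support (mass z) ⊆ S
  support-mass⊆S z {x} x∈ with lookup S x in Sx
  ... | true  = VecP.lookup⇒[]= x S Sx
  ... | false = ⊥-elim (ℚP.<-irrefl (sym (ℚP.*-zeroˡ (f x z)))
                  (subst (λ b → 0ℚ <ℚ 𝟙 b * f x z) Sx (support⁻ (mass z) x∈)))

  support-mass⊆ball : ∀ {r k} → r ≤ k → (∀ x z → within G r x z ≡ false → f x z ≡ 0ℚ) →
                      ∀ z → support (mass z) ⊆ ball G k z
  support-mass⊆ball {r} {k} r≤k local z {x} x∈ = ∈-tabulate⁺ (within G k z) (within-mono G r≤k (within-sym G r x~z))
    where
    x~z : within G r x z ≡ true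
    x~z with within G r x z in w
    ... | true  = refl
    ... | false = ⊥-elim (ℚP.<-irrefl (sym (local x z w))
                    (subst (0ℚ <ℚ_) (mass-on-S z (VecP.[]=⇒lookup (support-mass⊆S z x∈))) (support⁻ (mass z) x∈)))

  module _ (∑f≡1 : ∀ x → sum (f x) ≡ 1ℚ) where

    total-mass : ∑[ z < n G ] sum (mass z) ≡ ℕtoℚ ∣ S ∣
    total-mass = begin
      ∑[ z < n G ] (∑[ x < n G ] (𝟙 (lookup S x) * f x z))  ≡⟨ ∑-comm (λ z x → mass z x) ⟩
      ∑[ x < n G ] (∑[ z < n G ] (𝟙 (lookup S x) * f x z))  ≡⟨ sum-cong-≗ (λ x → sym (*-distribˡ-sum (𝟙 (lookup S x)) (f x))) ⟩
      ∑[ x < n G ] (𝟙 (lookup S x) * sum (f x))             ≡⟨ sum-cong-≗ (λ x → trans (cong (𝟙 (lookup S x) *_) (∑f≡1 x))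
                                                                                    (ℚP.*-identityʳ (𝟙 (lookup S x)))) ⟩
      ∑[ x < n G ] 𝟙 (lookup S x)                           ≡⟨ sym (ℕtoℚ-∣p∣ S) ⟩
      ℕtoℚ ∣ S ∣                                            ∎
      where open ≡-Reasoning

    module _ {ε : ℚ} (close : ∀ x y → adj G x y ≡ true → ∑[ z < n G ] ℚ.∣ f x z - f y z ∣ <ℚ ε) where

      edge-spread : ∀ {x y} → edge G S x y ≡ true → ∑[ z < n G ] ((mass z x - mass z y) ⁺) ≤ℚ ½ * ε
      edge-spread {x} {y} e = begin
        ∑[ z < n G ] ((mass z x - mass z y) ⁺)   ≡⟨ sum-cong-≗ (λ z → cong₂ (λ a b → (a - b) ⁺) (mass-on-S z Sx) (mass-on-S z Sy)) ⟩
        ∑[ z < n G ] ((f x z - f y z) ⁺)         ≡⟨ sum-⁺-difference (f x) (f y) (trans (∑f≡1 x) (sym (∑f≡1 y))) ⟩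
        ½ * ∑[ z < n G ] ℚ.∣ f x z - f y z ∣     ≤⟨ ℚP.*-monoˡ-≤-nonNeg ½ (ℚP.<⇒≤ (close x y adj≡)) ⟩
        ½ * ε                                    ∎
        where
        open ℚP.≤-Reasoning
        Sx   = BoolP.∧-conicalˡ (lookup S x) _ e
        adj≡ = BoolP.∧-conicalˡ (adj G x y) _ (BoolP.∧-conicalʳ (lookup S x) _ e)
        Sy   = BoolP.∧-conicalʳ (adj G x y) _ (BoolP.∧-conicalʳ (lookup S x) _ e)

      module _ {d : ℕ} (0≤ε : 0ℚ ≤ℚ ε) (deg≤d : InGr d G) where

        private
          c = (ℕtoℚ d * ε) * ½

        total-variation : ∑[ z < n G ] variation G S (mass z) ≤ℚ c * ℕtoℚ ∣ S ∣
        total-variation = begin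
          ∑[ z < n G ] (∑[ x < n G ] (∑[ y < n G ] (𝟙 (edge G S x y) * (mass z x - mass z y) ⁺)))
            ≡⟨ ∑-comm (λ z x → ∑[ y < n G ] (𝟙 (edge G S x y) * (mass z x - mass z y) ⁺)) ⟩
          ∑[ x < n G ] (∑[ z < n G ] (∑[ y < n G ] (𝟙 (edge G S x y) * (mass z x - mass z y) ⁺)))
            ≡⟨ sum-cong-≗ (λ x → ∑-comm (λ z y → 𝟙 (edge G S x y) * (mass z x - mass z y) ⁺)) ⟩
          ∑[ x < n G ] (∑[ y < n G ] (∑[ z < n G ] (𝟙 (edge G S x y) * (mass z x - mass z y) ⁺)))
            ≤⟨ sum-mono-≤ row ⟩
          ∑[ x < n G ] (c * 𝟙 (lookup S x))
            ≡⟨ sym (*-distribˡ-sum c (λ x → 𝟙 (lookup S x))) ⟩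
          c * ∑[ x < n G ] 𝟙 (lookup S x)
            ≡⟨ cong (c *_) (sym (ℕtoℚ-∣p∣ S)) ⟩
          c * ℕtoℚ ∣ S ∣ ∎
          where
          open ℚP.≤-Reasoning

          0≤½ε : 0ℚ ≤ℚ ½ * ε
          0≤½ε = *-nonNeg (ℚP.nonNegative⁻¹ ½) 0≤ε

          row : ∀ x → ∑[ y < n G ] (∑[ z < n G ] (𝟙 (edge G S x y) * (mass z x - mass z y) ⁺)) ≤ℚ c * 𝟙 (lookup S x)
          row x = begin
            ∑[ y < n G ] (∑[ z < n G ] (𝟙 (edge G S x y) * (mass z x - mass z y) ⁺))
              ≡⟨ sum-cong-≗ (λ y → sym (*-distribˡ-sum (𝟙 (edge G S x y)) (λ z → (mass z x - mass z y) ⁺))) ⟩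
            ∑[ y < n G ] (𝟙 (edge G S x y) * ∑[ z < n G ] ((mass z x - mass z y) ⁺))
              ≤⟨ sum-mono-≤ (λ y → 𝟙-*-mono-≤ (edge G S x y) edge-spread) ⟩
            ∑[ y < n G ] (𝟙 (edge G S x y) * (½ * ε))
              ≡⟨ sym (*-distribʳ-sum (½ * ε) (λ y → 𝟙 (edge G S x y))) ⟩
            ∑[ y < n G ] 𝟙 (edge G S x y) * (½ * ε)
              ≤⟨ ℚP.*-monoʳ-≤-nonNeg (½ * ε) {{ℚ.nonNegative 0≤½ε}} (induced-degree≤ G S deg≤d x) ⟩
            (𝟙 (lookup S x) * ℕtoℚ d) * (½ * ε)
              ≡⟨ solve 4 (λ i d h e → (i :* d) :* (h :* e) := ((d :* e) :* h) :* i) refl (𝟙 (lookup S x)) (ℕtoℚ d) ½ ε ⟩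
            c * 𝟙 (lookup S x) ∎

        ∃-centre-with-small-variation : (∀ x z → 0ℚ ≤ℚ f x z) → Nonempty S →
          ∃ λ z → 0ℚ <ℚ sum (mass z) × variation G S (mass z) ≤ℚ c * sum (mass z)
        ∃-centre-with-small-variation 0≤f nonempty =
          ratio-pigeonhole c (λ z → variation G S (mass z)) (λ z → sum (mass z))
            (λ z → variation-nonNeg G S (mass z)) (λ z → sum-nonNeg (mass-nonNeg 0≤f z))
            (subst (0ℚ <ℚ_) (sym total-mass) (ℕtoℚ-∣p∣-positive nonempty))
            (subst (_ ≤ℚ_) (cong (c *_) (sym total-mass)) total-variation)

lemma7p3 : (d : ℕ) (ε : ℚ) (r : ℕ) → 1 < d → 0ℚ ℚ.< ε → 1 ≤ r →
    (G : Graph) → InA d ε r G →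
    (S : Subset (n G)) → Nonempty S →
    Σ (Subset (n G)) λ L → L ⊆ S × Nonempty L
      × ℕtoℚ ∣ boundary G S L ∣ ℚ.≤ ((ℕtoℚ d ℚ.* ε) ℚ.* ½) ℚ.* ℕtoℚ ∣ L ∣
      × ≤Nd ∣ L ∣ d (2 Data.Nat.* r)
lemma7p3 d ε r _ 0<ε _ G (deg≤d , f , 0≤f , ∑f≡1 , local , close) S S≠∅ =
  let (z , 0<∑mass , var≤) = ∃-centre-with-small-variation G S f ∑f≡1′ close′ (ℚP.<⇒≤ 0<ε) deg≤d 0≤f S≠∅
      (L , L⊆supp , L≠∅ , small) = small-superlevel-set G S ((ℕtoℚ d * ε) * ½) (mass G S f z) (mass-nonNeg G S f 0≤f z)
                                          (support-mass⊆S G S f z) 0<∑mass var≤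
  in L , SubsetP.⊆-trans L⊆supp (support-mass⊆S G S f z) , L≠∅ , small ,
     G , deg≤d , z , SubsetP.p⊆q⇒∣p∣≤∣q∣ (SubsetP.⊆-trans L⊆supp (support-mass⊆ball G S f r≤2r local z))
  where
  ∑f≡1′ : ∀ x → sum (f x) ≡ 1ℚ
  ∑f≡1′ x = trans (sym (sumFin≡sum (f x))) (∑f≡1 x)

  close′ : ∀ x y → adj G x y ≡ true → ∑[ z < n G ] ℚ.∣ f x z - f y z ∣ <ℚ ε
  close′ x y x~y = subst (_<ℚ ε) (sumFin≡sum (λ z → ℚ.∣ f x z - f y z ∣)) (close x y x~y)

  r≤2r : r ≤ 2 ℕ.* r
  r≤2r = ℕP.m≤m+n r (r ℕ.+ 0)
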